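{- Let $\mathsf{K}_{\mathsf{At}}$ be an FH model and $HMS(\mathsf{K}_{\mathsf{At}})$ its HMS transform. For all $w \in W_{\mathsf{At}}$, all $\varphi \in \mathcal{L}_{\mathsf{At}}$, and all $\Phi \subseteq \mathsf{At}$ with $\mathsf{At}(\varphi) \subseteq \Phi$: $\mathsf{K}_{\mathsf{At}}, w \Vdash \varphi$ if and only if $HMS(\mathsf{K}_{\mathsf{At}}), w_\Phi \vDash \varphi$.
   Context: Fix nonempty sets $\mathsf{At}$ (atoms) and $I$ (agents). Language $\mathcal{L}_{\mathsf{At}}$: $\varphi ::= \top \mid p \mid \neg\varphi \mid \varphi\wedge\psi \mid \ell_i\varphi \mid a_i\varphi \mid k_i\varphi$; $\mathsf{At}(\varphi)$ atoms of $\varphi$; $\mathsf{At}(X) := \bigcup_{\varphi\in X}\mathsf{At}(\varphi)$; $\mathcal{L}_\Phi := \{\varphi : \mathsf{At}(\varphi) \subseteq \Phi\}$. FH model $\mathsf{K}_\Phi = \langle I, W_\Phi, (R_{\Phi,i}), (\mathcal{A}_{\Phi,i}), V_\Phi\rangle$: $W_\Phi \neq \emptyset$; $R_{\Phi,i}$ equivalence relations; $\mathcal{A}_{\Phi,i}: W_\Phi \to 2^{\mathcal{L}_\Phi}$ with $\varphi \in \mathcal{A}_{\Phi,i}(w)$ iff $\mathsf{At}(\varphi) \subseteq \mathcal{A}_{\Phi,i}(w)$ and $(w,t)\in R_{\Phi,i} \Rightarrow \mathcal{A}_{\Phi,i}(w) = \mathcal{A}_{\Phi,i}(t)$; $V_\Phi: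 \Phi \to 2^{W_\Phi}$. Satisfaction: $\top$ always; $p$ iff $w \in V_\Phi(p)$; Boolean clauses standard; $a_i\varphi$ iff $\varphi \in \mathcal{A}_{\Phi,i}(w)$; $\ell_i\varphi$ iff $\varphi$ holds at all $R_{\Phi,i}$-successors; $k_i\varphi$ iff $\ell_i\varphi$ and $a_i\varphi$. Surjective bounded morphism $f^\Phi_\Psi: W_\Phi \to W_\Psi$ ($\Psi\subseteq\Phi$): surjective; $w \in V_\Phi(p) \iff f^\Phi_\Psi(w) \in V_\Psi(p)$ for $p\in\Psi$; $\mathcal{A}_{\Phi,i}(w)\cap\mathcal{L}_\Psi = \mathcal{A}_{\Psi,i}(f^\Phi_\Psi(w))$; preserves $R_i$; back condition (if $(f^\Phi_\Psi(w),t')\in R_{\Psi,i}$ there is $t$ with $f^\Phi_\Psi(t)=t'$, $(w,t)\in R_{\Phi,i}$). A category of FH models $\mathcal{C}(\mathsf{K}_{\mathsf{At}})$ for the given $\mathsf{K}_{\mathsf{At}}$: FH models $\mathsf{K}_\Phi$ for all $\Phi \subseteq \mathsf{At}$ (the top one being $\mathsf{K}_{\mathsf{At}}$) with surjective bounded morphisms $f^\Phi_\Psi$, $f^\Phi_\Phi$ identity, $f^\Phi_\Upsilon = f^\Psi_\Upsilon\circ f^\Phi_\Psi$. HMS transform $HMS(\mathsf{K}_{\mathsf{At}}) = \langle I, \{S_\Phi\}, (r^\Phi_\Psi), (\Lambda^*_i), (\Pi^*_i), v\rangle$: $S_\Phi := W_\Phi$ (pairwise disjoint), $\Omega := \bigcup_\Phi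 S_\Phi$, $r^\Phi_\Psi := f^\Phi_\Psi$; for $w \in S_\Phi$, $\Lambda^*_i(w) := \{w' : (w,w') \in R_{\Phi,i}\}$; for $w\in S_\Psi$, $\alpha_i(w) := S_{\mathsf{At}(\mathcal{A}_{\Psi,i}(w))}$; $v(p) := \bigcup_{\Phi \ni p} V_\Phi(p)$; and $\Pi^*_i(\omega_\Phi) := \Lambda^*_i(\omega)_{\alpha_i(\omega_\Phi)}$ for $\omega \in \Omega$, $S_\Phi \preceq S_\omega$. Here $S_\Psi \preceq S_\Phi$ iff $\Psi \subseteq \Phi$; $S_\omega$ is the space containing $\omega$; $\omega_\Psi := r^\Phi_\Psi(\omega)$; $D_\Psi := r^\Phi_\Psi(D)$ and $D_S := D_\Psi$ for $S=S_\Psi$; $D^\uparrow := \bigcup_{\Phi\subseteq\Psi}(r^\Psi_\Phi)^{ -1}(D)$ for $D\subseteq S_\Phi$. Events: sets $E = D^\uparrow$ with $D\subseteq S_\Phi$, base-space $S(E) := S_\Phi$ (distinct vacuous events $\emptyset^{S_\Phi}$ for each $\Phi$); negation $\neg E := (S_\Phi\setminus D)^\uparrow$; conjunction intersection. Satisfaction in a complemented HMS model $\overline{\mathsf{M}}$ with correspondences $\Lambda_i,\Pi_i$ (here $\Lambda^*_i,\Pi^*_i$), writing $[\varphi] := \{\omega : \overline{\mathsf{M}},\omega\vDash\varphi\}$ and $S_{\Pi_i(\omega)}$ for the space containing $\Pi_i(\omega)$: $\top$ holds everywhere; $p$ iff $\omega\in v(p)$; $\neg\varphi$ iff $\omega \in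 \neg[\varphi]$; $\varphi\wedge\psi$ iff $\omega\in[\varphi]\cap[\psi]$; $a_i\varphi$ iff $S_{\Pi_i(\omega)} \succeq S([\varphi])$; $\ell_i\varphi$ iff $\Lambda_i(\omega)\subseteq[\varphi]$; $k_i\varphi$ iff $\Pi_i(\omega)\subseteq[\varphi]$. -}

module Defs where

open import Level using (0ℓ)
open import Data.Unit using (⊤; tt)
open import Data.Product using (Σ; ∃; _×_; _,_)
open import Data.Sum using (_⊎_)
open import Relation.Nullary using (¬_)
open import Relation.Unary using (Pred; _⊆_; _∈_; _∩_; _≐_; U)
open import Relation.Binary using (IsEquivalence)
open import Relation.Binary.PropositionalEquality using (_≡_)
open import Function.Bundles using (_⇔_)

data Form (At I : Set) : Set where
  ⊤ᶠ   : Form At I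
  atom : At → Form At I
  ¬ᶠ_  : Form At I → Form At I
  _∧ᶠ_ : Form At I → Form At I → Form At I
  ℓᶠ   : I → Form At I → Form At I
  aᶠ   : I → Form At I → Form At I
  kᶠ   : I → Form At I → Form At I

module _ {At I : Set} where

  AtOf : Form At I → Pred At 0ℓ
  AtOf ⊤ᶠ         q = Data.Empty.⊥ where import Data.Empty
  AtOf (atom p)   q = p ≡ q
  AtOf (¬ᶠ φ)     q = AtOf φ q
  AtOf (φ ∧ᶠ ψ)   q = AtOf φ q ⊎ AtOf ψ q
  AtOf (ℓᶠ i φ)   q = AtOf φ q
  AtOf (aᶠ i φ)   q = AtOf φ q
  AtOf (kᶠ i φ)   q = AtOf φ q

  AtOfSet : Pred (Form At I) 0ℓ → Pred At 0ℓ
  AtOfSet X p = ∃ λ φ → X φ × AtOf φ p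

  L : Pred At 0ℓ → Pred (Form At I) 0ℓ
  L Φ φ = AtOf φ ⊆ Φ

record FHModel (At I : Set) (Φ : Pred At 0ℓ) : Set₁ where
  field
    W        : Set
    W-ne     : W
    R        : I → W → W → Set
    R-equiv  : ∀ i → IsEquivalence (R i)
    𝒜        : I → W → Pred (Form At I) 0ℓ
    𝒜⊆L      : ∀ i w {φ} → φ ∈ 𝒜 i w → φ ∈ L Φ
    𝒜-gen    : ∀ i w φ → (φ ∈ 𝒜 i w) ⇔ (AtOf φ ⊆ (λ p → atom p ∈ 𝒜 i w))
    𝒜-R      : ∀ i {w t} → R i w t → 𝒜 i w ≐ 𝒜 i t
    V        : (p : At) → .(p ∈ Φ) → Pred W 0ℓ

record IsSBM {At I : Set} {Φ Ψ : Pred At 0ℓ} (Ψ⊆Φ : Ψ ⊆ Φ)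
             (M : FHModel At I Φ) (N : FHModel At I Ψ)
             (f : FHModel.W M → FHModel.W N) : Set₁ where
  private
    module M = FHModel M
    module N = FHModel N
  field
    surj  : ∀ y → ∃ λ x → f x ≡ y
    val   : ∀ p (h : p ∈ Ψ) w → (w ∈ M.V p (Ψ⊆Φ h)) ⇔ (f w ∈ N.V p h)
    aware : ∀ i w → (M.𝒜 i w ∩ L Ψ) ≐ N.𝒜 i (f w)
    forth : ∀ i {w t} → M.R i w t → N.R i (f w) (f t)
    back  : ∀ i {w t′} → N.R i (f w) t′ → ∃ λ t → f t ≡ t′ × M.R i w t

-- A category of FH models C(K_At): one model per Φ ⊆ At (the top one,
-- K U, being K_At), with surjective bounded morphisms f^Φ_Ψ.
record FHCategory (At I : Set) : Set₁ where
  field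
    K      : (Φ : Pred At 0ℓ) → FHModel At I Φ
    f      : (Φ Ψ : Pred At 0ℓ) → .(Ψ ⊆ Φ) → FHModel.W (K Φ) → FHModel.W (K Ψ)
    f-sbm  : ∀ Φ Ψ (h : Ψ ⊆ Φ) → IsSBM h (K Φ) (K Ψ) (f Φ Ψ h)
    f-id   : ∀ Φ (h : Φ ⊆ Φ) w → f Φ Φ h w ≡ w
    f-comp : ∀ Φ Ψ Υ (h₁ : Ψ ⊆ Φ) (h₂ : Υ ⊆ Ψ) (h₃ : Υ ⊆ Φ) w →
             f Φ Υ h₃ w ≡ f Ψ Υ h₂ (f Φ Ψ h₁ w)

_,_⊩_ : {At I : Set} (M : FHModel At I U) → FHModel.W M → Form At I → Set
M , w ⊩ ⊤ᶠ       = ⊤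
M , w ⊩ atom p   = w ∈ FHModel.V M p tt
M , w ⊩ (¬ᶠ φ)   = ¬ (M , w ⊩ φ)
M , w ⊩ (φ ∧ᶠ ψ) = (M , w ⊩ φ) × (M , w ⊩ ψ)
M , w ⊩ ℓᶠ i φ   = ∀ t → FHModel.R M i w t → M , t ⊩ φ
M , w ⊩ aᶠ i φ   = φ ∈ FHModel.𝒜 M i w
M , w ⊩ kᶠ i φ   = (∀ t → FHModel.R M i w t → M , t ⊩ φ) × (φ ∈ FHModel.𝒜 M i w)

module HMS {At I : Set} (C : FHCategory At I) where
  open FHCategory C

  -- Ω = disjoint union of the spaces S_Φ := W_Φ
  Ω : Set₁
  Ω = Σ (Pred At 0ℓ) (λ Φ → FHModel.W (K Φ))

  r : (Φ Ψ : Pred At 0ℓ) → .(Ψ ⊆ Φ) → FHModel.W (K Φ) → FHModel.W (K Ψ)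
  r = f

  Λ* : I → (ω : Ω) → Pred (FHModel.W (K (Data.Product.proj₁ ω))) 0ℓ
  Λ* i (Φ , w) w′ = FHModel.R (K Φ) i w w′

  -- α_i(w) := S_{At(A_{Ψ,i}(w))}  (we record the index At(A_{Ψ,i}(w)))
  α : I → Ω → Pred At 0ℓ
  α i (Ψ , w) = AtOfSet (FHModel.𝒜 (K Ψ) i w)

  α⊆ : ∀ i Ψ w → α i (Ψ , w) ⊆ Ψ
  α⊆ i Ψ w (φ , φ∈ , p∈) = FHModel.𝒜⊆L (K Ψ) i w φ∈ p∈

  Π* : (i : I) (ω : Ω) → Pred (FHModel.W (K (α i ω))) 0ℓ
  Π* i (Ψ , w) y = ∃ λ t → Λ* i (Ψ , w) t × r Ψ (α i (Ψ , w)) (α⊆ i Ψ w) t ≡ y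

  v : At → Pred Ω 0ℓ
  v p (Φ , w) = Σ (p ∈ Φ) λ h → w ∈ FHModel.V (K Φ) p h

  -- Satisfaction; the base space S([φ]) of the event [φ] is S_{At(φ)}.
  _⊨_ : Ω → Form At I → Set
  ω       ⊨ ⊤ᶠ       = ⊤
  ω       ⊨ atom p   = ω ∈ v p
  (Ψ , w) ⊨ (¬ᶠ φ)   = Σ (AtOf φ ⊆ Ψ) λ h → ¬ ((AtOf φ , r Ψ (AtOf φ) h w) ⊨ φ)
  ω       ⊨ (φ ∧ᶠ ψ) = (ω ⊨ φ) × (ω ⊨ ψ)
  (Ψ , w) ⊨ aᶠ i φ   = AtOf φ ⊆ α i (Ψ , w)
  (Ψ , w) ⊨ ℓᶠ i φ   = ∀ w′ → w′ ∈ Λ* i (Ψ , w) → (Ψ , w′) ⊨ φ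
  (Ψ , w) ⊨ kᶠ i φ   = ∀ y → y ∈ Π* i (Ψ , w) → (α i (Ψ , w) , y) ⊨ φ

restrict : {At I : Set} (C : FHCategory At I) (Φ : Pred At 0ℓ) →
           FHModel.W (FHCategory.K C U) → FHModel.W (FHCategory.K C Φ)
restrict C Φ w = FHCategory.f C U Φ (λ _ → tt) w

{-# OPTIONS --safe #-}
-- Induction on φ, for all target spaces S_Φ at once. Atoms transfer by the
-- valuation clause of f^At_Φ, ℓ_i by its forth and back conditions, and a_i
-- because awareness is generated by atoms and preserved by f^At_Φ on L_Φ, so
-- φ ∈ 𝒜_{At,i}(w) exactly when At(φ) ⊆ α_i(w_Φ). Negation and k_i move the
-- evaluation down to a smaller space S_Ψ; there the induction hypothesis at Ψ
-- applies because w_Ψ = f^Φ_Ψ(w_Φ). For k_i the atoms of φ lie in α_i(w_Φ)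
-- since HMS satisfaction at a space forces the atoms of φ into it.
module Submission where

open import Defs
open import Level using (0ℓ)
open import Data.Unit using (tt)
open import Data.Product using (∃; _×_; _,_; proj₁; proj₂)
open import Data.Product.Function.NonDependent.Propositional using (_×-⇔_)
open import Data.Sum using (inj₁; inj₂)
open import Relation.Unary using (Pred; _⊆_; _∈_; U)
open import Relation.Binary using (IsEquivalence)
open import Relation.Binary.PropositionalEquality using (_≡_; refl; sym)
open import Function.Base using (_∘_)
open import Function.Bundles using (_⇔_; mk⇔; Equivalence)
open import Function.Construct.Identity using (⇔-id)
open import Function.Construct.Composition using (_⇔-∘_)
open import Function.Related.TypeIsomorphisms using (¬-cong-⇔)

open Equivalence using (to; from)

subst-⇔ : ∀ {a} {A : Set a} (P : A → Set) {x y : A} → x ≡ y → P x ⇔ P y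
subst-⇔ P refl = ⇔-id _

module _ {At I : Set} {Φ : Pred At 0ℓ} (M : FHModel At I Φ) where
  open FHModel M

  R-refl : ∀ i {w} → R i w w
  R-refl i = IsEquivalence.refl (R-equiv i)

  ∈𝒜⇔AtOf⊆AtOfSet𝒜 : ∀ i w φ → φ ∈ 𝒜 i w ⇔ AtOf φ ⊆ AtOfSet (𝒜 i w)
  ∈𝒜⇔AtOf⊆AtOfSet𝒜 i w φ = mk⇔ witnessed generated
    where
    witnessed : φ ∈ 𝒜 i w → AtOf φ ⊆ AtOfSet (𝒜 i w)
    witnessed φ∈𝒜 p∈φ = φ , φ∈𝒜 , p∈φ

    atom∈𝒜 : ∀ {p} → p ∈ AtOfSet (𝒜 i w) → atom p ∈ 𝒜 i w
    atom∈𝒜 (ψ , ψ∈𝒜 , p∈ψ) = to (𝒜-gen i w ψ) ψ∈𝒜 p∈ψ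

    generated : AtOf φ ⊆ AtOfSet (𝒜 i w) → φ ∈ 𝒜 i w
    generated atoms⊆ = from (𝒜-gen i w φ) (atom∈𝒜 ∘ atoms⊆)

module _ {At I : Set} {Φ Ψ : Pred At 0ℓ} {Ψ⊆Φ : Ψ ⊆ Φ}
         {M : FHModel At I Φ} {N : FHModel At I Ψ}
         {f : FHModel.W M → FHModel.W N} (f-sbm : IsSBM Ψ⊆Φ M N f) where
  open IsSBM f-sbm

  ∈𝒜⇔∈𝒜-image : ∀ i w {φ} → φ ∈ L Ψ →
                 φ ∈ FHModel.𝒜 M i w ⇔ φ ∈ FHModel.𝒜 N i (f w)
  ∈𝒜⇔∈𝒜-image i w φ∈L = mk⇔
    (λ φ∈𝒜 → proj₁ (aware i w) (φ∈𝒜 , φ∈L))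
    (proj₁ ∘ proj₂ (aware i w))

module _ {At I : Set} (C : FHCategory At I) where
  open FHCategory C
  open HMS C

  private
    KAt : FHModel At I U
    KAt = K U

    module KAt = FHModel KAt

    _↓_ : KAt.W → (Φ : Pred At 0ℓ) → FHModel.W (K Φ)
    w ↓ Φ = restrict C Φ w

    restrict-sbm : ∀ Φ → IsSBM (λ _ → tt) KAt (K Φ) (_↓ Φ)
    restrict-sbm Φ = f-sbm U Φ (λ _ → tt)

  restrict-∘ : ∀ Φ Ψ (Ψ⊆Φ : Ψ ⊆ Φ) w → f Φ Ψ Ψ⊆Φ (w ↓ Φ) ≡ w ↓ Ψ
  restrict-∘ Φ Ψ Ψ⊆Φ w = sym (f-comp U Φ Ψ (λ _ → tt) Ψ⊆Φ (λ _ → tt) w)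

  ⊨⇒AtOf⊆ : ∀ φ Ψ w → (Ψ , w) ⊨ φ → AtOf φ ⊆ Ψ
  ⊨⇒AtOf⊆ ⊤ᶠ       Ψ w _ ()
  ⊨⇒AtOf⊆ (atom p) Ψ w (p∈Ψ , _) refl      = p∈Ψ
  ⊨⇒AtOf⊆ (¬ᶠ φ)   Ψ w (φ⊆Ψ , _)           = φ⊆Ψ
  ⊨⇒AtOf⊆ (φ ∧ᶠ ψ) Ψ w (⊨φ , _) (inj₁ p∈φ) = ⊨⇒AtOf⊆ φ Ψ w ⊨φ p∈φ
  ⊨⇒AtOf⊆ (φ ∧ᶠ ψ) Ψ w (_ , ⊨ψ) (inj₂ p∈ψ) = ⊨⇒AtOf⊆ ψ Ψ w ⊨ψ p∈ψ
  ⊨⇒AtOf⊆ (ℓᶠ i φ) Ψ w ⊨ℓφ                 = ⊨⇒AtOf⊆ φ Ψ w (⊨ℓφ w (R-refl (K Ψ) i))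
  ⊨⇒AtOf⊆ (aᶠ i φ) Ψ w φ⊆α                 = α⊆ i Ψ w ∘ φ⊆α
  ⊨⇒AtOf⊆ (kᶠ i φ) Ψ w ⊨kφ                 =
    α⊆ i Ψ w ∘ ⊨⇒AtOf⊆ φ (α i (Ψ , w)) _ (⊨kφ _ (w , R-refl (K Ψ) i , refl))

  ∈𝒜⇔AtOf⊆α : ∀ i w φ Φ → AtOf φ ⊆ Φ →
              φ ∈ KAt.𝒜 i w ⇔ AtOf φ ⊆ α i (Φ , w ↓ Φ)
  ∈𝒜⇔AtOf⊆α i w φ Φ φ⊆Φ =
    ∈𝒜⇔AtOf⊆AtOfSet𝒜 (K Φ) i (w ↓ Φ) φ ⇔-∘ ∈𝒜⇔∈𝒜-image (restrict-sbm Φ) i w φ⊆Φ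

  Π*⇒R : ∀ i Φ {w y} → y ∈ Π* i (Φ , w ↓ Φ) →
         ∃ λ t → KAt.R i w t × f Φ (α i (Φ , w ↓ Φ)) (α⊆ i Φ (w ↓ Φ)) (t ↓ Φ) ≡ y
  Π*⇒R i Φ (t′ , w↓Rt′ , t′↓≡y) with IsSBM.back (restrict-sbm Φ) i w↓Rt′
  ... | t , refl , wRt = t , wRt , t′↓≡y

  ⊩⇔⊨ : ∀ φ Φ w → AtOf φ ⊆ Φ → (KAt , w ⊩ φ) ⇔ ((Φ , w ↓ Φ) ⊨ φ)
  ⊩⇔⊨-below : ∀ φ Φ Ψ (Ψ⊆Φ : Ψ ⊆ Φ) w → AtOf φ ⊆ Ψ →
              (KAt , w ⊩ φ) ⇔ ((Ψ , f Φ Ψ Ψ⊆Φ (w ↓ Φ)) ⊨ φ)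

  ⊩⇔⊨-below φ Φ Ψ Ψ⊆Φ w φ⊆Ψ =
    subst-⇔ (λ x → (Ψ , x) ⊨ φ) (sym (restrict-∘ Φ Ψ Ψ⊆Φ w))
      ⇔-∘ ⊩⇔⊨ φ Ψ w φ⊆Ψ

  ⊩⇔⊨ ⊤ᶠ       Φ w φ⊆Φ = ⇔-id _
  ⊩⇔⊨ (atom p) Φ w φ⊆Φ = mk⇔
    (λ ⊩p → φ⊆Φ refl , to (IsSBM.val (restrict-sbm Φ) p (φ⊆Φ refl) w) ⊩p)
    (λ { (p∈Φ , ⊨p) → from (IsSBM.val (restrict-sbm Φ) p p∈Φ w) ⊨p })
  ⊩⇔⊨ (¬ᶠ φ)   Φ w φ⊆Φ =
    paired ⇔-∘ ¬-cong-⇔ (⊩⇔⊨-below φ Φ (AtOf φ) φ⊆Φ w (λ p∈φ → p∈φ))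
    where
    paired : ∀ {B : Set} → B ⇔ (AtOf φ ⊆ Φ × B)
    paired = mk⇔ {B = AtOf φ ⊆ Φ × _} (φ⊆Φ ,_) proj₂
  ⊩⇔⊨ (φ ∧ᶠ ψ) Φ w φ⊆Φ = ⊩⇔⊨ φ Φ w (φ⊆Φ ∘ inj₁) ×-⇔ ⊩⇔⊨ ψ Φ w (φ⊆Φ ∘ inj₂)
  ⊩⇔⊨ (ℓᶠ i φ) Φ w φ⊆Φ = mk⇔ forward backward
    where
    forward : KAt , w ⊩ ℓᶠ i φ → (Φ , w ↓ Φ) ⊨ ℓᶠ i φ
    forward ⊩ℓφ w′ w↓Rw′ with IsSBM.back (restrict-sbm Φ) i w↓Rw′
    ... | t , refl , wRt = to (⊩⇔⊨ φ Φ t φ⊆Φ) (⊩ℓφ t wRt)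

    backward : (Φ , w ↓ Φ) ⊨ ℓᶠ i φ → KAt , w ⊩ ℓᶠ i φ
    backward ⊨ℓφ t wRt =
      from (⊩⇔⊨ φ Φ t φ⊆Φ) (⊨ℓφ (t ↓ Φ) (IsSBM.forth (restrict-sbm Φ) i wRt))
  ⊩⇔⊨ (aᶠ i φ) Φ w φ⊆Φ = ∈𝒜⇔AtOf⊆α i w φ Φ φ⊆Φ
  ⊩⇔⊨ (kᶠ i φ) Φ w φ⊆Φ = mk⇔ forward backward
    where
    A : Pred At 0ℓ
    A = α i (Φ , w ↓ Φ)

    A⊆Φ : A ⊆ Φ
    A⊆Φ = α⊆ i Φ (w ↓ Φ)

    forward : KAt , w ⊩ kᶠ i φ → (Φ , w ↓ Φ) ⊨ kᶠ i φ
    forward (⊩ℓφ , φ∈𝒜) y y∈Π* with Π*⇒R i Φ y∈Π*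
    ... | t , wRt , refl =
      to (⊩⇔⊨-below φ Φ A A⊆Φ t (to (∈𝒜⇔AtOf⊆α i w φ Φ φ⊆Φ) φ∈𝒜)) (⊩ℓφ t wRt)

    backward : (Φ , w ↓ Φ) ⊨ kᶠ i φ → KAt , w ⊩ kᶠ i φ
    backward ⊨kφ = ⊩ℓφ , from (∈𝒜⇔AtOf⊆α i w φ Φ φ⊆Φ) φ⊆A
      where
      φ⊆A : AtOf φ ⊆ A
      φ⊆A = ⊨⇒AtOf⊆ φ A _ (⊨kφ _ (w ↓ Φ , R-refl (K Φ) i , refl))

      ⊩ℓφ : KAt , w ⊩ ℓᶠ i φ
      ⊩ℓφ t wRt = from (⊩⇔⊨-below φ Φ A A⊆Φ t φ⊆A)
                       (⊨kφ _ (t ↓ Φ , IsSBM.forth (restrict-sbm Φ) i wRt , refl))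

proposition10 : (At I : Set) → At → I → (C : FHCategory At I) →
    (w : FHModel.W (FHCategory.K C U)) (φ : Form At I) (Φ : Pred At 0ℓ) →
    AtOf φ ⊆ Φ →
    (FHCategory.K C U , w ⊩ φ) ⇔ HMS._⊨_ C (Φ , restrict C Φ w) φ
proposition10 At I _ _ C w φ Φ = ⊩⇔⊨ C φ Φ w
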